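{- Let $(G,\epsilon)$ be an $n$-vertex signed graph with $m$ edges, and let $k=p^r$ be a power of a prime. If $\chi(G,\epsilon)\le k$ and $m\le(k-1)n$, then $$P((G,\epsilon),k)\ge k^{\,n-\frac{m}{k-1}}.$$
   Context: A signed graph $(G,\epsilon)$ is a graph $G$ with a map $\epsilon:E(G)\to\{ -1,1\}$. The color sets are $M_{2t+1}=\{0,\pm1,\dots,\pm t\}$ and $M_{2t}=\{\pm1,\dots,\pm t\}$. A $k$-coloring of $(G,\epsilon)$ is a map $\kappa:V(G)\to M_k$ such that $\kappa(v)\ne\epsilon(e)\kappa(u)$ for every edge $e=uv$. $P((G,\epsilon),k)$ is the number of $k$-colorings of $(G,\epsilon)$, and $\chi(G,\epsilon)$ is the least $k$ such that $(G,\epsilon)$ has a $k$-coloring. -}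

module Defs where

open import Data.Nat using (ℕ; zero; suc; _/_; _<_)
open import Data.Integer using (ℤ; +_; -_; _*_; 1ℤ; -1ℤ)
import Data.Integer.Properties as ℤP
open import Data.Fin using (Fin)
import Data.Fin as F
open import Data.Vec using (Vec; []; _∷_; lookup)
open import Data.List using (List; []; _∷_; length; filter; concatMap; map)
open import Data.List.Membership.Propositional using (_∈_)
open import Data.List.Relation.Unary.All using (All)
import Data.List.Relation.Unary.All as All
open import Data.List.Relation.Unary.AllPairs using (AllPairs)
open import Data.Product using (_×_; _,_; ∃; Σ)
open import Relation.Nullary using (¬_; Dec)
import Relation.Nullary.Decidable as Dec
open import Relation.Binary.PropositionalEquality using (_≡_)

data Sign : Set where
  pos neg : Sign

signVal : Sign → ℤ
signVal pos = 1ℤ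
signVal neg = -1ℤ

Edge : ℕ → Set
Edge n = Fin n × Fin n × Sign

-- Two edges have distinct (unordered, here ordered with u<v) endpoint pairs.
DistinctPair : ∀ {n} → Edge n → Edge n → Set
DistinctPair (u , v , _) (u' , v' , _) = ¬ ((u ≡ u') × (v ≡ v'))

record SignedGraph (n : ℕ) : Set where
  field
    edges  : List (Edge n)
    noLoop : All (λ e → let (u , v , _) = e in u F.< v) edges
    simple : AllPairs DistinctPair edges

open SignedGraph public

numEdges : ∀ {n} → SignedGraph n → ℕ
numEdges G = length (edges G)

-- The colour set M_k:  M_{2t+1} = {0, ±1, …, ±t},  M_{2t} = {±1, …, ±t}.
-- Recursively: M_0 = ∅, M_1 = {0}, M_{k+2} = M_k ∪ {±(⌊k/2⌋+1)}.
M : ℕ → List ℤ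
M zero = []
M (suc zero) = + 0 ∷ []
M (suc (suc k)) = + (suc (k / 2)) ∷ - + (suc (k / 2)) ∷ M k

EdgeOK : ∀ {n} → (Fin n → ℤ) → Edge n → Set
EdgeOK κ (u , v , s) = ¬ (κ v ≡ signVal s * κ u)

IsColoring : ∀ {n} → SignedGraph n → ℕ → (Fin n → ℤ) → Set
IsColoring {n} G k κ = ((x : Fin n) → κ x ∈ M k) × All (EdgeOK κ) (edges G)

ChiAtMost : ∀ {n} → SignedGraph n → ℕ → Set
ChiAtMost G k = ∃ λ j → (j Data.Nat.≤ k) × ∃ λ κ → IsColoring G j κ

assignments : List ℤ → (n : ℕ) → List (Vec ℤ n)
assignments L zero = [] ∷ []
assignments L (suc n) = concatMap (λ c → map (c ∷_) (assignments L n)) L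

edgeOK? : ∀ {n} (κ : Fin n → ℤ) (e : Edge n) → Dec (EdgeOK κ e)
edgeOK? κ (u , v , s) = Dec.¬? (κ v ℤP.≟ signVal s * κ u)

P : ∀ {n} → SignedGraph n → ℕ → ℕ
P {n} G k = length (filter (λ w → All.all? (edgeOK? (lookup w)) (edges G))
                           (assignments (M k) n))

-- The k-colourings of (G, ε) are the points of the grid M_k ^ n at which the edge polynomial
-- ∏_{uv} (x_v − ε(uv) x_u), of degree m, does not vanish, and M_k consists of k distinct integers.
-- A colouring with at most k colours can be turned into one with exactly k colours, so this polynomial
-- is not identically zero on the grid, and a weak form of the Alon–Füredi theorem applies: a polynomial
-- of degree d over ℤ that is nonzero somewhere on A ^ n, |A| = k, is nonzero at k ^ (n − d/(k−1)) or
-- more points. Reduce the degree in the first variable below k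
-- modulo ∏_{a ∈ A} (t − a) and take the highest coefficient h not vanishing on the grid, say of tʲ,
-- of degree at most d − j. Over each point where h ≠ 0 the fibre is a polynomial of degree j in t,
-- nonzero at k − j or more points of A, and (k − j) ^ (k − 1) ≥ k ^ (k − 1 − j) closes the induction.

module Submission where

open import Defs

module Sums where

  open import Data.Nat
  open import Data.Nat.Properties
  open import Data.List using (List; []; _∷_; map; concatMap; _++_)
  open import Data.List.Membership.Propositional using (_∈_)
  open import Data.List.Relation.Unary.Any using (here; there)
  open import Data.Nat.Tactic.RingSolver using (solve-∀)
  open import Function using (_∘_)
  open import Relation.Binary.PropositionalEquality

  private variable X Y : Set

  ∑ : List X → (X → ℕ) → ℕ
  ∑ []       f = 0
  ∑ (x ∷ xs) f = f x + ∑ xs f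

  syntax ∑ xs (λ x → e) = ∑[ x ∈ xs ] e

  ∑-cong : ∀ (xs : List X) {f g : X → ℕ} → (∀ {x} → x ∈ xs → f x ≡ g x) → ∑ xs f ≡ ∑ xs g
  ∑-cong []       eq = refl
  ∑-cong (x ∷ xs) eq = cong₂ _+_ (eq (here refl)) (∑-cong xs (eq ∘ there))

  ∑-mono-≤ : ∀ (xs : List X) {f g : X → ℕ} → (∀ {x} → x ∈ xs → f x ≤ g x) → ∑ xs f ≤ ∑ xs g
  ∑-mono-≤ []       le = z≤n
  ∑-mono-≤ (x ∷ xs) le = +-mono-≤ (le (here refl)) (∑-mono-≤ xs (le ∘ there))

  ∑-distrib-+ : ∀ (xs : List X) (f g : X → ℕ) → ∑[ x ∈ xs ] (f x + g x) ≡ ∑ xs f + ∑ xs g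
  ∑-distrib-+ []       f g = refl
  ∑-distrib-+ (x ∷ xs) f g =
    trans (cong (f x + g x +_) (∑-distrib-+ xs f g)) (interchange (f x) (g x) (∑ xs f) (∑ xs g))
    where
    interchange : ∀ a b c d → a + b + (c + d) ≡ a + c + (b + d)
    interchange = solve-∀

  *-distribˡ-∑ : ∀ c (xs : List X) (f : X → ℕ) → c * ∑ xs f ≡ ∑[ x ∈ xs ] (c * f x)
  *-distribˡ-∑ c []       f = *-zeroʳ c
  *-distribˡ-∑ c (x ∷ xs) f = trans (*-distribˡ-+ c (f x) _) (cong (c * f x +_) (*-distribˡ-∑ c xs f))

  ∑-++ : ∀ (xs ys : List X) (f : X → ℕ) → ∑ (xs ++ ys) f ≡ ∑ xs f + ∑ ys f
  ∑-++ []       ys f = refl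
  ∑-++ (x ∷ xs) ys f = trans (cong (f x +_) (∑-++ xs ys f)) (sym (+-assoc (f x) _ _))

  ∑-map : ∀ (g : X → Y) (xs : List X) (f : Y → ℕ) → ∑ (map g xs) f ≡ ∑[ x ∈ xs ] f (g x)
  ∑-map g []       f = refl
  ∑-map g (x ∷ xs) f = cong (f (g x) +_) (∑-map g xs f)

  ∑-comm : ∀ (xs : List X) (ys : List Y) (f : X → Y → ℕ) →
           ∑[ x ∈ xs ] ∑[ y ∈ ys ] f x y ≡ ∑[ y ∈ ys ] ∑[ x ∈ xs ] f x y
  ∑-comm []       ys f = sym (∑-zero ys)
    where
    ∑-zero : (ys : List Y) → ∑[ y ∈ ys ] 0 ≡ 0
    ∑-zero []       = refl
    ∑-zero (y ∷ ys) = ∑-zero ys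
  ∑-comm (x ∷ xs) ys f = trans (cong (∑ ys (f x) +_) (∑-comm xs ys f))
                               (sym (∑-distrib-+ ys (f x) λ y → ∑[ x′ ∈ xs ] f x′ y))

  ∑-concatMap : ∀ (g : X → List Y) (xs : List X) (f : Y → ℕ) →
                ∑ (concatMap g xs) f ≡ ∑[ x ∈ xs ] ∑ (g x) f
  ∑-concatMap g []       f = refl
  ∑-concatMap g (x ∷ xs) f = trans (∑-++ (g x) (concatMap g xs) f) (cong (∑ (g x) f +_) (∑-concatMap g xs f))

module Univariate where

  open import Data.Nat using (suc)
  open import Data.Integer hiding (suc)
  open import Data.Integer.Properties using (*-zeroʳ; +-identityˡ; +-identityʳ; *-identityˡ)
  open import Data.Integer.Tactic.RingSolver using (solve-∀)
  open import Data.List using (List; []; _∷_; map; _++_; length)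
  open import Data.Empty using (⊥)
  open import Relation.Nullary using (¬_)
  open import Relation.Binary.PropositionalEquality

  ⟦_⟧ : List ℤ → ℤ → ℤ
  ⟦ []     ⟧ t = 0ℤ
  ⟦ c ∷ cs ⟧ t = c + t * ⟦ cs ⟧ t

  ⟦[c]⟧≡c : ∀ c t → ⟦ c ∷ [] ⟧ t ≡ c
  ⟦[c]⟧≡c c t = trans (cong (λ u → c + u) (*-zeroʳ t)) (+-identityʳ c)

  infixl 6 _⊕_

  _⊕_ : List ℤ → List ℤ → List ℤ
  []       ⊕ ds       = ds
  (c ∷ cs) ⊕ []       = c ∷ cs
  (c ∷ cs) ⊕ (d ∷ ds) = c + d ∷ cs ⊕ ds

  ⟦⟧-⊕ : ∀ cs ds t → ⟦ cs ⊕ ds ⟧ t ≡ ⟦ cs ⟧ t + ⟦ ds ⟧ t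
  ⟦⟧-⊕ []       ds       t = sym (+-identityˡ _)
  ⟦⟧-⊕ (c ∷ cs) []       t = sym (+-identityʳ _)
  ⟦⟧-⊕ (c ∷ cs) (d ∷ ds) t = begin
    c + d + t * ⟦ cs ⊕ ds ⟧ t              ≡⟨ cong (λ u → c + d + t * u) (⟦⟧-⊕ cs ds t) ⟩
    c + d + t * (⟦ cs ⟧ t + ⟦ ds ⟧ t)      ≡⟨ interchange c d t (⟦ cs ⟧ t) (⟦ ds ⟧ t) ⟩
    c + t * ⟦ cs ⟧ t + (d + t * ⟦ ds ⟧ t)  ∎
    where
    open ≡-Reasoning
    interchange : ∀ c d t x y → c + d + t * (x + y) ≡ c + t * x + (d + t * y)
    interchange = solve-∀

  ⟦⟧-map-* : ∀ a cs t → ⟦ map (a *_) cs ⟧ t ≡ a * ⟦ cs ⟧ t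
  ⟦⟧-map-* a []       t = sym (*-zeroʳ a)
  ⟦⟧-map-* a (c ∷ cs) t = trans (cong (λ u → a * c + t * u) (⟦⟧-map-* a cs t)) (factor a c t (⟦ cs ⟧ t))
    where
    factor : ∀ a c t x → a * c + t * (a * x) ≡ a * (c + t * x)
    factor = solve-∀

  ⟦⟧-++ : ∀ cs ds t → ⟦ cs ++ ds ⟧ t ≡ ⟦ cs ⟧ t + t ^ length cs * ⟦ ds ⟧ t
  ⟦⟧-++ []       ds t = sym (trans (+-identityˡ _) (*-identityˡ _))
  ⟦⟧-++ (c ∷ cs) ds t = trans (cong (λ u → c + t * u) (⟦⟧-++ cs ds t)) (expand c t (⟦ cs ⟧ t) (t ^ length cs) (⟦ ds ⟧ t))
    where
    expand : ∀ c t x p y → c + t * (x + p * y) ≡ c + t * x + t * p * y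
    expand = solve-∀

  LeadingNonZero : List ℤ → Set
  LeadingNonZero []           = ⊥
  LeadingNonZero (c ∷ [])     = ¬ c ≡ 0ℤ
  LeadingNonZero (_ ∷ c ∷ cs) = LeadingNonZero (c ∷ cs)

  -- Synthetic division by t - α: the quotient's coefficients are the Horner partial sums at α.
  quotient : ℤ → List ℤ → List ℤ
  quotient α []           = []
  quotient α (c ∷ [])     = []
  quotient α (_ ∷ c ∷ cs) = ⟦ c ∷ cs ⟧ α ∷ quotient α (c ∷ cs)

  ⟦⟧-quotient : ∀ α cs t → ⟦ cs ⟧ t ≡ ⟦ cs ⟧ α + (t - α) * ⟦ quotient α cs ⟧ t
  ⟦⟧-quotient α []           t = sym (trans (+-identityˡ _) (*-zeroʳ (t - α)))
  ⟦⟧-quotient α (c ∷ [])     t = trans (⟦[c]⟧≡c c t) (sym (trans (cong (λ u → u + (t - α) * 0ℤ) (⟦[c]⟧≡c c α))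
                                                                  (⟦[c]⟧≡c c (t - α))))
  ⟦⟧-quotient α (c ∷ d ∷ cs) t = begin
    c + t * ⟦ d ∷ cs ⟧ t                             ≡⟨ cong (λ u → c + t * u) (⟦⟧-quotient α (d ∷ cs) t) ⟩
    c + t * (⟦ d ∷ cs ⟧ α + (t - α) * ⟦ q ⟧ t)       ≡⟨ regroup c t α (⟦ d ∷ cs ⟧ α) (⟦ q ⟧ t) ⟩
    c + α * ⟦ d ∷ cs ⟧ α + (t - α) * (⟦ d ∷ cs ⟧ α + t * ⟦ q ⟧ t) ∎
    where
    open ≡-Reasoning
    q = quotient α (d ∷ cs)
    regroup : ∀ c t α r y → c + t * (r + (t - α) * y) ≡ c + α * r + (t - α) * (r + t * y)
    regroup = solve-∀

  length-quotient : ∀ α c cs → length (quotient α (c ∷ cs)) ≡ length cs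
  length-quotient α c []       = refl
  length-quotient α c (d ∷ cs) = cong suc (length-quotient α d cs)

  quotient-leadingNonZero : ∀ α c d cs → LeadingNonZero (c ∷ d ∷ cs) → LeadingNonZero (quotient α (c ∷ d ∷ cs))
  quotient-leadingNonZero α c d []       d≢0 = λ eq → d≢0 (trans (sym (⟦[c]⟧≡c d α)) eq)
  quotient-leadingNonZero α c d (e ∷ cs) lead = quotient-leadingNonZero α d e cs lead

module NonZeroCount where

  open import Data.Nat
  open import Data.Nat.Properties
  open import Data.Integer as ℤ using (ℤ; 0ℤ)
  import Data.Integer.Properties as ℤ
  open import Data.List using (List; []; _∷_; length)
  open import Data.List.Relation.Unary.All as All using ()
  open import Data.List.Relation.Unary.AllPairs using (AllPairs; _∷_)
  open import Data.Sum using ([_,_]′)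
  open import Data.Empty using (⊥-elim)
  open import Data.Bool using (if_then_else_)
  open import Relation.Nullary using (yes; no; ¬_; does)
  open import Relation.Binary.PropositionalEquality
  open Sums
  open Univariate

  private variable X : Set

  indicator≢0 : ℤ → ℕ
  indicator≢0 z = if does (z ℤ.≟ 0ℤ) then 0 else 1

  indicator≢0-≢0 : ∀ {z} → ¬ z ≡ 0ℤ → indicator≢0 z ≡ 1
  indicator≢0-≢0 {z} z≢0 with z ℤ.≟ 0ℤ
  ... | yes z≡0 = ⊥-elim (z≢0 z≡0)
  ... | no  _   = refl

  indicator≢0-* : ∀ a b → ¬ a ≡ 0ℤ → indicator≢0 (a ℤ.* b) ≡ indicator≢0 b
  indicator≢0-* a b a≢0 with b ℤ.≟ 0ℤ
  ... | yes refl = cong indicator≢0 (ℤ.*-zeroʳ a)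
  ... | no  b≢0  = indicator≢0-≢0 λ ab≡0 → [ a≢0 , b≢0 ]′ (ℤ.i*j≡0⇒i≡0∨j≡0 a ab≡0)

  *-indicator≢0-≤ : ∀ a z {s} → (¬ z ≡ 0ℤ → a ≤ s) → a * indicator≢0 z ≤ s
  *-indicator≢0-≤ a z z≢0⇒a≤s with z ℤ.≟ 0ℤ
  ... | yes _   = ≤-trans (≤-reflexive (*-zeroʳ a)) z≤n
  ... | no  z≢0 = ≤-trans (≤-reflexive (*-identityʳ a)) (z≢0⇒a≤s z≢0)

  countNonZero : List X → (X → ℤ) → ℕ
  countNonZero xs f = ∑[ x ∈ xs ] indicator≢0 (f x)

  length≤countNonZero+degree : ∀ (A : List ℤ) → AllPairs (λ a b → ¬ a ≡ b) A →
    ∀ j c cs → length (c ∷ cs) ≡ suc j → LeadingNonZero (c ∷ cs) → length A ≤ countNonZero A ⟦ c ∷ cs ⟧ + j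
  length≤countNonZero+degree []      _ j c cs _ _ = z≤n
  length≤countNonZero+degree (α ∷ A) (α∉A ∷ distinct) j c cs len lead with ⟦ c ∷ cs ⟧ α ℤ.≟ 0ℤ
  ... | no _ = s≤s (length≤countNonZero+degree A distinct j c cs len lead)
  length≤countNonZero+degree (α ∷ A) (α∉A ∷ distinct) zero c [] _ c≢0 | yes c≡0 =
    ⊥-elim (c≢0 (trans (sym (⟦[c]⟧≡c c α)) c≡0))
  length≤countNonZero+degree (α ∷ A) (α∉A ∷ distinct) (suc j) c (d ∷ cs) len lead | yes w[α]≡0 = begin
      suc (length A)
        ≤⟨ s≤s (length≤countNonZero+degree A distinct j (⟦ d ∷ cs ⟧ α) (quotient α (d ∷ cs)) len′ lead′) ⟩
      suc (countNonZero A ⟦ q ⟧ + j)                 ≡⟨ cong (λ n → suc (n + j)) (sym countNonZero-w≡q) ⟩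
      suc (countNonZero A ⟦ c ∷ d ∷ cs ⟧ + j)        ≡⟨ +-suc _ j ⟨
      countNonZero A ⟦ c ∷ d ∷ cs ⟧ + suc j          ∎
    where
    open ≤-Reasoning
    q = quotient α (c ∷ d ∷ cs)
    len′ : length q ≡ suc j
    len′ = trans (length-quotient α c (d ∷ cs)) (suc-injective len)
    lead′ : LeadingNonZero q
    lead′ = quotient-leadingNonZero α c d cs lead
    w≡[t-α]q : ∀ t → ⟦ c ∷ d ∷ cs ⟧ t ≡ (t ℤ.- α) ℤ.* ⟦ q ⟧ t
    w≡[t-α]q t = trans (⟦⟧-quotient α (c ∷ d ∷ cs) t)
                       (trans (cong (λ x → x ℤ.+ (t ℤ.- α) ℤ.* ⟦ q ⟧ t) w[α]≡0) (ℤ.+-identityˡ _))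
    countNonZero-w≡q : countNonZero A ⟦ c ∷ d ∷ cs ⟧ ≡ countNonZero A ⟦ q ⟧
    countNonZero-w≡q = ∑-cong A λ {t} t∈A →
      trans (cong indicator≢0 (w≡[t-α]q t))
            (indicator≢0-* (t ℤ.- α) (⟦ q ⟧ t) λ t-α≡0 → All.lookup α∉A t∈A (sym (ℤ.i-j≡0⇒i≡j t α t-α≡0)))

module Polynomial where

  open import Data.Nat using (ℕ; zero; suc; _≤_; _⊔_; z≤n)
  open import Data.Nat.Properties using (≤-pred)
  open import Data.Integer using (ℤ; 0ℤ; 1ℤ; _+_; _*_; _-_)
  open import Data.List using (List; []; _∷_; map; length)
  open import Data.Integer.Properties using (+-identityˡ; +-identityʳ; *-identityˡ)
  open import Data.Integer.Tactic.RingSolver using (solve-∀)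
  open import Data.Vec using (Vec; _∷_; lookup)
  open import Data.Fin using (Fin; zero; suc)
  open import Data.Product using (Σ; _×_; _,_)
  open import Data.Unit using (⊤; tt)
  open import Relation.Binary.PropositionalEquality
  open Univariate

  Fun : ℕ → Set
  Fun n = Vec ℤ n → ℤ

  _at_ : ∀ {n} → List (Fun n) → Vec ℤ n → List ℤ
  gs at x = map (λ g → g x) gs

  -- f (t ∷ x) = ∑ᵢ gᵢ(x) tⁱ with deg gᵢ ≤ d ∸ i: f is a polynomial function of total degree at most d.
  mutual
    IsPolynomial : (n d : ℕ) → Fun n → Set
    IsPolynomial zero    d f = ⊤
    IsPolynomial (suc n) d f =
      Σ (List (Fun n)) λ gs → IsCoefficientList n d gs × (∀ t x → f (t ∷ x) ≡ ⟦ gs at x ⟧ t)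

    IsCoefficientList : (n d : ℕ) → List (Fun n) → Set
    IsCoefficientList n d       []       = ⊤
    IsCoefficientList n zero    (g ∷ gs) = IsPolynomial n zero g × gs ≡ []
    IsCoefficientList n (suc d) (g ∷ gs) = IsPolynomial n (suc d) g × IsCoefficientList n d gs

  IsCoefficientList-singleton : ∀ n d {g : Fun n} → IsPolynomial n d g → IsCoefficientList n d (g ∷ [])
  IsCoefficientList-singleton n zero    p = p , refl
  IsCoefficientList-singleton n (suc d) p = p , tt

  infixl 6 _⊕ᶠ_

  _⊕ᶠ_ : ∀ {n} → List (Fun n) → List (Fun n) → List (Fun n)
  []       ⊕ᶠ hs       = hs
  (g ∷ gs) ⊕ᶠ []       = g ∷ gs
  (g ∷ gs) ⊕ᶠ (h ∷ hs) = (λ x → g x + h x) ∷ gs ⊕ᶠ hs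

  ⊕ᶠ-at : ∀ {n} (gs hs : List (Fun n)) x → (gs ⊕ᶠ hs) at x ≡ (gs at x) ⊕ (hs at x)
  ⊕ᶠ-at []       hs       x = refl
  ⊕ᶠ-at (g ∷ gs) []       x = refl
  ⊕ᶠ-at (g ∷ gs) (h ∷ hs) x = cong (g x + h x ∷_) (⊕ᶠ-at gs hs x)

  length-⊕ᶠ : ∀ {n} (gs hs : List (Fun n)) → length (gs ⊕ᶠ hs) ≡ length gs ⊔ length hs
  length-⊕ᶠ []       hs       = refl
  length-⊕ᶠ (g ∷ gs) []       = refl
  length-⊕ᶠ (g ∷ gs) (h ∷ hs) = cong suc (length-⊕ᶠ gs hs)

  ⟦⟧-⊕ᶠ : ∀ {n} (gs hs : List (Fun n)) x t → ⟦ (gs ⊕ᶠ hs) at x ⟧ t ≡ ⟦ gs at x ⟧ t + ⟦ hs at x ⟧ t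
  ⟦⟧-⊕ᶠ gs hs x t = trans (cong (λ cs → ⟦ cs ⟧ t) (⊕ᶠ-at gs hs x)) (⟦⟧-⊕ (gs at x) (hs at x) t)

  mulᶠ : ∀ {n} → Fun n → List (Fun n) → List (Fun n)
  mulᶠ L = map (λ g x → L x * g x)

  mulᶠ-at : ∀ {n} L (gs : List (Fun n)) x → mulᶠ L gs at x ≡ map (L x *_) (gs at x)
  mulᶠ-at L []       x = refl
  mulᶠ-at L (g ∷ gs) x = cong (L x * g x ∷_) (mulᶠ-at L gs x)

  ⟦⟧-mulᶠ : ∀ {n} L (gs : List (Fun n)) x t → ⟦ mulᶠ L gs at x ⟧ t ≡ L x * ⟦ gs at x ⟧ t
  ⟦⟧-mulᶠ L gs x t = trans (cong (λ cs → ⟦ cs ⟧ t) (mulᶠ-at L gs x)) (⟦⟧-map-* (L x) (gs at x) t)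

  IsPolynomial-const : ∀ n d c → IsPolynomial n d (λ _ → c)
  IsPolynomial-const zero    d c = tt
  IsPolynomial-const (suc n) d c =
    ((λ _ → c) ∷ []) , IsCoefficientList-singleton n d (IsPolynomial-const n d c) , λ t x → sym (⟦[c]⟧≡c c t)

  mutual
    IsPolynomial-mono : ∀ n {d d′} {f : Fun n} → d ≤ d′ → IsPolynomial n d f → IsPolynomial n d′ f
    IsPolynomial-mono zero    d≤d′ _              = tt
    IsPolynomial-mono (suc n) d≤d′ (gs , cl , eq) = gs , IsCoefficientList-mono n gs d≤d′ cl , eq

    IsCoefficientList-mono : ∀ n {d d′} (gs : List (Fun n)) → d ≤ d′ → IsCoefficientList n d gs → IsCoefficientList n d′ gs
    IsCoefficientList-mono n []       _          _             = tt
    IsCoefficientList-mono n {zero}  {zero}   (g ∷ gs) _   cl        = cl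
    IsCoefficientList-mono n {zero}  {suc d′} (g ∷ .[]) _  (p , refl) = IsPolynomial-mono n z≤n p , tt
    IsCoefficientList-mono n {suc d} {suc d′} (g ∷ gs) d≤d′ (p , cl) =
      IsPolynomial-mono n d≤d′ p , IsCoefficientList-mono n gs (≤-pred d≤d′) cl

  mutual
    IsPolynomial-+ : ∀ n d {f g : Fun n} → IsPolynomial n d f → IsPolynomial n d g → IsPolynomial n d (λ x → f x + g x)
    IsPolynomial-+ zero    d _                _                = tt
    IsPolynomial-+ (suc n) d (gs , cl , f≡) (hs , cl′ , g≡) = gs ⊕ᶠ hs , IsCoefficientList-⊕ᶠ n d gs hs cl cl′ ,
      λ t x → trans (cong₂ _+_ (f≡ t x) (g≡ t x)) (sym (⟦⟧-⊕ᶠ gs hs x t))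

    IsCoefficientList-⊕ᶠ : ∀ n d (gs hs : List (Fun n)) →
      IsCoefficientList n d gs → IsCoefficientList n d hs → IsCoefficientList n d (gs ⊕ᶠ hs)
    IsCoefficientList-⊕ᶠ n d       []       hs       _          cl′         = cl′
    IsCoefficientList-⊕ᶠ n d       (g ∷ gs) []       cl         _           = cl
    IsCoefficientList-⊕ᶠ n zero    (g ∷ .[]) (h ∷ .[]) (p , refl) (q , refl) = IsPolynomial-+ n zero p q , refl
    IsCoefficientList-⊕ᶠ n (suc d) (g ∷ gs) (h ∷ hs) (p , cl)   (q , cl′)   =
      IsPolynomial-+ n (suc d) p q , IsCoefficientList-⊕ᶠ n d gs hs cl cl′

  mutual
    IsPolynomial-scale : ∀ n d a {f : Fun n} → IsPolynomial n d f → IsPolynomial n d (λ x → a * f x)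
    IsPolynomial-scale zero    d a _              = tt
    IsPolynomial-scale (suc n) d a (gs , cl , f≡) = mulᶠ (λ _ → a) gs , IsCoefficientList-scale n d a gs cl ,
      λ t x → trans (cong (a *_) (f≡ t x)) (sym (⟦⟧-mulᶠ (λ _ → a) gs x t))

    IsCoefficientList-scale : ∀ n d a (gs : List (Fun n)) → IsCoefficientList n d gs → IsCoefficientList n d (mulᶠ (λ _ → a) gs)
    IsCoefficientList-scale n d       a []        _          = tt
    IsCoefficientList-scale n zero    a (g ∷ .[]) (p , refl) = IsPolynomial-scale n zero a p , refl
    IsCoefficientList-scale n (suc d) a (g ∷ gs)  (p , cl)   = IsPolynomial-scale n (suc d) a p , IsCoefficientList-scale n d a gs cl

  IsAffine : (n : ℕ) → Fun n → Set
  IsAffine zero    L = ⊤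
  IsAffine (suc n) L = Σ ℤ λ a → Σ (Fun n) λ L′ → IsAffine n L′ × (∀ t x → L (t ∷ x) ≡ a * t + L′ x)

  IsAffine-const : ∀ n c → IsAffine n (λ _ → c)
  IsAffine-const zero    c = tt
  IsAffine-const (suc n) c = 0ℤ , (λ _ → c) , IsAffine-const n c , λ t x → sym (+-identityˡ c)

  IsAffine-lookup : ∀ n (i : Fin n) → IsAffine n (λ x → lookup x i)
  IsAffine-lookup (suc n) zero    = 1ℤ , (λ _ → 0ℤ) , IsAffine-const n 0ℤ , λ t x → sym (trans (+-identityʳ _) (*-identityˡ t))
  IsAffine-lookup (suc n) (suc i) = 0ℤ , (λ x → lookup x i) , IsAffine-lookup n i , λ t x → sym (+-identityˡ (lookup x i))

  IsAffine-sub : ∀ n c {L₁ L₂ : Fun n} → IsAffine n L₁ → IsAffine n L₂ → IsAffine n (λ x → L₁ x - c * L₂ x)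
  IsAffine-sub zero    c _                      _                      = tt
  IsAffine-sub (suc n) c (a , L₁′ , aff₁ , L₁≡) (b , L₂′ , aff₂ , L₂≡) =
    a - c * b , (λ x → L₁′ x - c * L₂′ x) , IsAffine-sub n c aff₁ aff₂ ,
    λ t x → trans (cong₂ (λ u v → u - c * v) (L₁≡ t x) (L₂≡ t x)) (collect a b c t (L₁′ x) (L₂′ x))
    where
    collect : ∀ a b c t u v → a * t + u - c * (b * t + v) ≡ (a - c * b) * t + (u - c * v)
    collect = solve-∀

  mutual
    IsPolynomial-*-affine : ∀ n d {f L : Fun n} → IsPolynomial n d f → IsAffine n L → IsPolynomial n (suc d) (λ x → L x * f x)
    IsPolynomial-*-affine zero    d _              _                     = tt
    IsPolynomial-*-affine (suc n) d (gs , cl , f≡) (a , L′ , aff , L≡) =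
      mulᶠ L′ gs ⊕ᶠ ((λ _ → 0ℤ) ∷ mulᶠ (λ _ → a) gs) ,
      IsCoefficientList-⊕ᶠ n (suc d) _ _ (IsCoefficientList-*-affine n d gs cl aff)
                                        (IsPolynomial-const n (suc d) 0ℤ , IsCoefficientList-scale n d a gs cl) ,
      λ t x → begin
        _                                          ≡⟨ cong₂ _*_ (L≡ t x) (f≡ t x) ⟩
        (a * t + L′ x) * ⟦ gs at x ⟧ t             ≡⟨ expand a t (L′ x) (⟦ gs at x ⟧ t) ⟩
        L′ x * ⟦ gs at x ⟧ t + (0ℤ + t * (a * ⟦ gs at x ⟧ t))
          ≡⟨ cong₂ (λ u v → u + (0ℤ + t * v)) (⟦⟧-mulᶠ L′ gs x t) (⟦⟧-mulᶠ (λ _ → a) gs x t) ⟨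
        ⟦ mulᶠ L′ gs at x ⟧ t + ⟦ ((λ _ → 0ℤ) ∷ mulᶠ (λ _ → a) gs) at x ⟧ t
          ≡⟨ ⟦⟧-⊕ᶠ (mulᶠ L′ gs) ((λ _ → 0ℤ) ∷ mulᶠ (λ _ → a) gs) x t ⟨
        _                                          ∎
      where
      open ≡-Reasoning
      expand : ∀ a t l y → (a * t + l) * y ≡ l * y + (0ℤ + t * (a * y))
      expand = solve-∀

    IsCoefficientList-*-affine : ∀ n d (gs : List (Fun n)) {L : Fun n} →
      IsCoefficientList n d gs → IsAffine n L → IsCoefficientList n (suc d) (mulᶠ L gs)
    IsCoefficientList-*-affine n d       []        _          _   = tt
    IsCoefficientList-*-affine n zero    (g ∷ .[]) (p , refl) aff = IsPolynomial-*-affine n zero p aff , tt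
    IsCoefficientList-*-affine n (suc d) (g ∷ gs)  (p , cl)   aff =
      IsPolynomial-*-affine n (suc d) p aff , IsCoefficientList-*-affine n d gs cl aff

module Reduction where

  open import Data.Nat as ℕ using (ℕ; zero; suc; _≤_; _⊔_; z≤n; s≤s; _≤?_)
  open import Data.Nat.Properties
    using (≤-refl; ≤-trans; ≤-reflexive; ≤-antisym; ≰⇒>; <⇒≤; ⊔-idem; ⊔-lub; +-comm; +-suc; m≤n+m; suc-injective)
  open import Data.Integer using (ℤ; 0ℤ; 1ℤ; -1ℤ; _+_; _-_; _*_; _^_)
  open import Data.Integer.Properties using (*-zeroʳ; +-identityˡ; *-comm)
  open import Data.Integer.Tactic.RingSolver using (solve-∀)
  open import Data.List using (List; []; _∷_; map; _++_; length; _∷ʳ_; InitLast; initLast; _∷ʳ′_)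
  open import Data.List.Properties using (length-map; length-++)
  open import Data.List.Membership.Propositional using (_∈_)
  open import Data.List.Relation.Unary.Any using (here; there)
  open import Data.Unit using (tt)
  open import Data.Product using (_,_)
  open import Relation.Nullary using (yes; no)
  open import Relation.Binary.PropositionalEquality
  open Univariate
  open Polynomial

  length-⊕ : ∀ cs ds → length (cs ⊕ ds) ≡ length cs ⊔ length ds
  length-⊕ []       ds       = refl
  length-⊕ (c ∷ cs) []       = refl
  length-⊕ (c ∷ cs) (d ∷ ds) = cong suc (length-⊕ cs ds)

  -- The polynomial t ^ |A| − ∏_{a ∈ A} (t − a), which has degree below |A| and agrees with t ^ |A| on A.
  remainder : List ℤ → List ℤ
  remainder []      = []
  remainder (α ∷ A) = (0ℤ ∷ remainder A) ⊕ map (α *_) (map (-1ℤ *_) (remainder A) ++ 1ℤ ∷ [])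

  length-remainder : ∀ A → length (remainder A) ≡ length A
  length-remainder []      = refl
  length-remainder (α ∷ A) = begin
    length (remainder (α ∷ A))                ≡⟨ length-⊕ (0ℤ ∷ N) (map (α *_) tail) ⟩
    suc (length N) ⊔ length (map (α *_) tail)    ≡⟨ cong (suc (length N) ⊔_) length-tail ⟩
    suc (length N) ⊔ suc (length N)           ≡⟨ ⊔-idem _ ⟩
    suc (length N)                            ≡⟨ cong suc (length-remainder A) ⟩
    suc (length A)                            ∎
    where
    open ≡-Reasoning
    N = remainder A
    tail = map (-1ℤ *_) N ++ 1ℤ ∷ []
    length-tail : length (map (α *_) tail) ≡ suc (length N)
    length-tail = trans (length-map _ tail) (trans (length-++ (map (-1ℤ *_) N)) (trans (cong (ℕ._+ 1) (length-map _ N)) (+-comm _ 1)))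

  ⟦⟧-remainder-∷ : ∀ α A t → ⟦ remainder (α ∷ A) ⟧ t ≡ t * ⟦ remainder A ⟧ t + α * (t ^ length A - ⟦ remainder A ⟧ t)
  ⟦⟧-remainder-∷ α A t = begin
    ⟦ (0ℤ ∷ N) ⊕ map (α *_) tail ⟧ t                        ≡⟨ ⟦⟧-⊕ (0ℤ ∷ N) (map (α *_) tail) t ⟩
    0ℤ + t * ⟦ N ⟧ t + ⟦ map (α *_) tail ⟧ t                ≡⟨ cong (0ℤ + t * ⟦ N ⟧ t +_) (⟦⟧-map-* α tail t) ⟩
    0ℤ + t * ⟦ N ⟧ t + α * ⟦ tail ⟧ t
      ≡⟨ cong (λ u → 0ℤ + t * ⟦ N ⟧ t + α * u) (⟦⟧-++ (map (-1ℤ *_) N) (1ℤ ∷ []) t) ⟩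
    0ℤ + t * ⟦ N ⟧ t + α * (⟦ map (-1ℤ *_) N ⟧ t + t ^ length (map (-1ℤ *_) N) * ⟦ 1ℤ ∷ [] ⟧ t)
      ≡⟨ cong₂ (λ u l → 0ℤ + t * ⟦ N ⟧ t + α * (u + t ^ l * ⟦ 1ℤ ∷ [] ⟧ t))
               (⟦⟧-map-* -1ℤ N t) (trans (length-map _ N) (length-remainder A)) ⟩
    0ℤ + t * ⟦ N ⟧ t + α * (-1ℤ * ⟦ N ⟧ t + t ^ length A * ⟦ 1ℤ ∷ [] ⟧ t)
      ≡⟨ cong (λ u → 0ℤ + t * ⟦ N ⟧ t + α * (-1ℤ * ⟦ N ⟧ t + t ^ length A * u)) (⟦[c]⟧≡c 1ℤ t) ⟩
    0ℤ + t * ⟦ N ⟧ t + α * (-1ℤ * ⟦ N ⟧ t + t ^ length A * 1ℤ)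
      ≡⟨ simplify t α (⟦ N ⟧ t) (t ^ length A) ⟩
    t * ⟦ N ⟧ t + α * (t ^ length A - ⟦ N ⟧ t)              ∎
    where
    open ≡-Reasoning
    N = remainder A
    tail = map (-1ℤ *_) N ++ 1ℤ ∷ []
    simplify : ∀ t α y p → 0ℤ + t * y + α * (-1ℤ * y + p * 1ℤ) ≡ t * y + α * (p - y)
    simplify = solve-∀

  ⟦⟧-remainder : ∀ A {t} → t ∈ A → ⟦ remainder A ⟧ t ≡ t ^ length A
  ⟦⟧-remainder (α ∷ A) {t} (here refl) = trans (⟦⟧-remainder-∷ α A α) (cancel α (⟦ remainder A ⟧ α) (α ^ length A))
    where
    cancel : ∀ α y p → α * y + α * (p - y) ≡ α * p
    cancel = solve-∀
  ⟦⟧-remainder (α ∷ A) {t} (there t∈A) rewrite ⟦⟧-remainder-∷ α A t | ⟦⟧-remainder A t∈A = cancel t α (t ^ length A)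
    where
    cancel : ∀ t α p → t * p + α * (p - p) ≡ t * p
    cancel = solve-∀

  module _ (A : List ℤ) where

    reduceTop : ∀ {cs : List ℤ} → InitLast cs → List ℤ
    reduceTop []         = []
    reduceTop (cs ∷ʳ′ c) = cs ⊕ map (c *_) (remainder A)

    reduce : List ℤ → List ℤ
    reduce cs with length cs ≤? length A
    ... | yes _ = cs
    ... | no  _ = reduceTop (initLast cs)

    length-init : ∀ cs (c : ℤ) {k} → length (cs ∷ʳ c) ≡ suc k → length cs ≡ k
    length-init cs c len = suc-injective (trans (sym (trans (length-++ cs) (+-comm (length cs) 1))) len)

    length-reduceTop : ∀ {cs : List ℤ} (v : InitLast cs) → length cs ≡ suc (length A) → length (reduceTop v) ≡ length A
    length-reduceTop []         ()
    length-reduceTop (cs ∷ʳ′ c) len = begin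
      length (cs ⊕ map (c *_) (remainder A))          ≡⟨ length-⊕ cs (map (c *_) (remainder A)) ⟩
      length cs ⊔ length (map (c *_) (remainder A))
        ≡⟨ cong₂ _⊔_ (length-init cs c len) (trans (length-map (c *_) (remainder A)) (length-remainder A)) ⟩
      length A ⊔ length A                              ≡⟨ ⊔-idem _ ⟩
      length A                                         ∎
      where open ≡-Reasoning

    ⟦⟧-reduceTop : ∀ {cs : List ℤ} (v : InitLast cs) → length cs ≡ suc (length A) → ∀ {t} → t ∈ A → ⟦ reduceTop v ⟧ t ≡ ⟦ cs ⟧ t
    ⟦⟧-reduceTop []         ()
    ⟦⟧-reduceTop (cs ∷ʳ′ c) len {t} t∈A = begin
      ⟦ cs ⊕ map (c *_) (remainder A) ⟧ t       ≡⟨ ⟦⟧-⊕ cs (map (c *_) (remainder A)) t ⟩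
      ⟦ cs ⟧ t + ⟦ map (c *_) (remainder A) ⟧ t  ≡⟨ cong (⟦ cs ⟧ t +_) (⟦⟧-map-* c (remainder A) t) ⟩
      ⟦ cs ⟧ t + c * ⟦ remainder A ⟧ t           ≡⟨ cong (λ u → ⟦ cs ⟧ t + c * u) (⟦⟧-remainder A t∈A) ⟩
      ⟦ cs ⟧ t + c * t ^ length A                ≡⟨ cong (λ l → ⟦ cs ⟧ t + c * t ^ l) (length-init cs c len) ⟨
      ⟦ cs ⟧ t + c * t ^ length cs               ≡⟨ cong (⟦ cs ⟧ t +_) (*-comm c _) ⟩
      ⟦ cs ⟧ t + t ^ length cs * c               ≡⟨ cong (λ u → ⟦ cs ⟧ t + t ^ length cs * u) (⟦[c]⟧≡c c t) ⟨
      ⟦ cs ⟧ t + t ^ length cs * ⟦ c ∷ [] ⟧ t    ≡⟨ ⟦⟧-++ cs (c ∷ []) t ⟨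
      ⟦ cs ∷ʳ c ⟧ t                              ∎
      where open ≡-Reasoning

    length-reduce≤size : ∀ cs → length cs ≤ suc (length A) → length (reduce cs) ≤ length A
    length-reduce≤size cs cs≤1+A with length cs ≤? length A
    ... | yes cs≤A = cs≤A
    ... | no  cs≰A = ≤-reflexive (length-reduceTop (initLast cs) (≤-antisym cs≤1+A (≰⇒> cs≰A)))

    length-reduce≤length : ∀ cs → length cs ≤ suc (length A) → length (reduce cs) ≤ length cs
    length-reduce≤length cs cs≤1+A with length cs ≤? length A
    ... | yes _    = ≤-refl
    ... | no  cs≰A =
      ≤-trans (≤-reflexive (length-reduceTop (initLast cs) (≤-antisym cs≤1+A (≰⇒> cs≰A)))) (<⇒≤ (≰⇒> cs≰A))

    ⟦⟧-reduce : ∀ cs → length cs ≤ suc (length A) → ∀ {t} → t ∈ A → ⟦ reduce cs ⟧ t ≡ ⟦ cs ⟧ t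
    ⟦⟧-reduce cs cs≤1+A t∈A with length cs ≤? length A
    ... | yes _    = refl
    ... | no  cs≰A = ⟦⟧-reduceTop (initLast cs) (≤-antisym cs≤1+A (≰⇒> cs≰A)) t∈A

    reducedPower : ℕ → List ℤ
    reducedPower zero    = reduce (1ℤ ∷ [])
    reducedPower (suc i) = reduce (0ℤ ∷ reducedPower i)

    length-reducedPower≤size : ∀ i → length (reducedPower i) ≤ length A
    length-reducedPower≤size zero    = length-reduce≤size (1ℤ ∷ []) (s≤s z≤n)
    length-reducedPower≤size (suc i) = length-reduce≤size (0ℤ ∷ reducedPower i) (s≤s (length-reducedPower≤size i))

    length-reducedPower≤suc : ∀ i → length (reducedPower i) ≤ suc i
    length-reducedPower≤suc zero    = length-reduce≤length (1ℤ ∷ []) (s≤s z≤n)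
    length-reducedPower≤suc (suc i) = ≤-trans (length-reduce≤length (0ℤ ∷ reducedPower i) (s≤s (length-reducedPower≤size i)))
                                              (s≤s (length-reducedPower≤suc i))

    ⟦⟧-reducedPower : ∀ i {t} → t ∈ A → ⟦ reducedPower i ⟧ t ≡ t ^ i
    ⟦⟧-reducedPower zero    {t} t∈A = trans (⟦⟧-reduce (1ℤ ∷ []) (s≤s z≤n) t∈A) (⟦[c]⟧≡c 1ℤ t)
    ⟦⟧-reducedPower (suc i) {t} t∈A = begin
      ⟦ reducedPower (suc i) ⟧ t      ≡⟨ ⟦⟧-reduce (0ℤ ∷ reducedPower i) (s≤s (length-reducedPower≤size i)) t∈A ⟩
      0ℤ + t * ⟦ reducedPower i ⟧ t   ≡⟨ +-identityˡ _ ⟩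
      t * ⟦ reducedPower i ⟧ t        ≡⟨ cong (t *_) (⟦⟧-reducedPower i t∈A) ⟩
      t * t ^ i                       ∎
      where open ≡-Reasoning

  _·ᶠ_ : ∀ {n} → List ℤ → Fun n → List (Fun n)
  zs ·ᶠ g = map (λ z x → z * g x) zs

  ⟦⟧-·ᶠ : ∀ {n} zs (g : Fun n) x t → ⟦ (zs ·ᶠ g) at x ⟧ t ≡ ⟦ zs ⟧ t * g x
  ⟦⟧-·ᶠ []       g x t = refl
  ⟦⟧-·ᶠ (z ∷ zs) g x t = trans (cong (λ u → z * g x + t * u) (⟦⟧-·ᶠ zs g x t)) (factor z (g x) t (⟦ zs ⟧ t))
    where
    factor : ∀ z y t w → z * y + t * (w * y) ≡ (z + t * w) * y
    factor = solve-∀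

  IsCoefficientList-·ᶠ : ∀ n j D zs {g : Fun n} → length zs ≤ suc j → IsPolynomial n D g → IsCoefficientList n (j ℕ.+ D) (zs ·ᶠ g)
  IsCoefficientList-·ᶠ n j       D       []           _         _ = tt
  IsCoefficientList-·ᶠ n zero    D       (z ∷ [])     _         p = IsCoefficientList-singleton n D (IsPolynomial-scale n D z p)
  IsCoefficientList-·ᶠ n zero    D       (_ ∷ _ ∷ _)  (s≤s ())  _
  IsCoefficientList-·ᶠ n (suc j) D       (z ∷ zs)     (s≤s len) p =
    IsPolynomial-mono n (m≤n+m D (suc j)) (IsPolynomial-scale n D z p) , IsCoefficientList-·ᶠ n j D zs len p

  module _ (A : List ℤ) where

    reduceᶠ : ∀ {n} → ℕ → List (Fun n) → List (Fun n)
    reduceᶠ i []       = []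
    reduceᶠ i (g ∷ gs) = reducedPower A i ·ᶠ g ⊕ᶠ reduceᶠ (suc i) gs

    ⟦⟧-reduceᶠ : ∀ {n} i (gs : List (Fun n)) x {t} → t ∈ A → ⟦ reduceᶠ i gs at x ⟧ t ≡ t ^ i * ⟦ gs at x ⟧ t
    ⟦⟧-reduceᶠ i []       x {t} _   = sym (*-zeroʳ (t ^ i))
    ⟦⟧-reduceᶠ i (g ∷ gs) x {t} t∈A = begin
      ⟦ (reducedPower A i ·ᶠ g ⊕ᶠ reduceᶠ (suc i) gs) at x ⟧ t
        ≡⟨ ⟦⟧-⊕ᶠ (reducedPower A i ·ᶠ g) (reduceᶠ (suc i) gs) x t ⟩
      ⟦ (reducedPower A i ·ᶠ g) at x ⟧ t + ⟦ reduceᶠ (suc i) gs at x ⟧ t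
        ≡⟨ cong₂ _+_ (trans (⟦⟧-·ᶠ (reducedPower A i) g x t) (cong (_* g x) (⟦⟧-reducedPower A i t∈A)))
                     (⟦⟧-reduceᶠ (suc i) gs x t∈A) ⟩
      t ^ i * g x + t * t ^ i * ⟦ gs at x ⟧ t
        ≡⟨ factor (t ^ i) (g x) t (⟦ gs at x ⟧ t) ⟩
      t ^ i * (g x + t * ⟦ gs at x ⟧ t) ∎
      where
      open ≡-Reasoning
      factor : ∀ p y t w → p * y + t * p * w ≡ p * (y + t * w)
      factor = solve-∀

    length-reduceᶠ : ∀ {n} i (gs : List (Fun n)) → length (reduceᶠ i gs) ≤ length A
    length-reduceᶠ i []       = z≤n
    length-reduceᶠ i (g ∷ gs) = ≤-trans (≤-reflexive (length-⊕ᶠ (reducedPower A i ·ᶠ g) (reduceᶠ (suc i) gs)))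
      (⊔-lub (≤-trans (≤-reflexive (length-map _ (reducedPower A i))) (length-reducedPower≤size A i)) (length-reduceᶠ (suc i) gs))

    IsCoefficientList-reduceᶠ : ∀ n i D (gs : List (Fun n)) → IsCoefficientList n D gs → IsCoefficientList n (i ℕ.+ D) (reduceᶠ i gs)
    IsCoefficientList-reduceᶠ n i D       []        _          = tt
    IsCoefficientList-reduceᶠ n i zero    (g ∷ .[]) (p , refl) =
      IsCoefficientList-⊕ᶠ n (i ℕ.+ zero) _ [] (IsCoefficientList-·ᶠ n i zero (reducedPower A i) (length-reducedPower≤suc A i) p) tt
    IsCoefficientList-reduceᶠ n i (suc D) (g ∷ gs)  (p , cl)   =
      IsCoefficientList-⊕ᶠ n (i ℕ.+ suc D) _ _ (IsCoefficientList-·ᶠ n i (suc D) (reducedPower A i) (length-reducedPower≤suc A i) p)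
        (subst (λ e → IsCoefficientList n e (reduceᶠ (suc i) gs)) (sym (+-suc i D)) (IsCoefficientList-reduceᶠ n (suc i) D gs cl))

module PowerInequalities where

  open import Data.Nat
  open import Data.Nat.Properties
  open import Data.Nat.Tactic.RingSolver using (solve-∀)
  open import Relation.Binary.PropositionalEquality

  ^-distribʳ-* : ∀ m n o → (m * n) ^ o ≡ m ^ o * n ^ o
  ^-distribʳ-* m n zero    = refl
  ^-distribʳ-* m n (suc o) = trans (cong (m * n *_) (^-distribʳ-* m n o)) (interchange m n (m ^ o) (n ^ o))
    where
    interchange : ∀ a b x y → a * b * (x * y) ≡ a * x * (b * y)
    interchange = solve-∀

  [1+k]^j≤[1+j]*k^j : ∀ k j → j ≤ k → suc k ^ j ≤ suc j * k ^ j
  [1+k]^j≤[1+j]*k^j k zero    _   = ≤-refl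
  [1+k]^j≤[1+j]*k^j k (suc j) j<k = begin
    suc k * suc k ^ j          ≤⟨ *-monoʳ-≤ (suc k) ([1+k]^j≤[1+j]*k^j k j (<⇒≤ j<k)) ⟩
    suc k * (suc j * k ^ j)    ≡⟨ *-assoc (suc k) (suc j) (k ^ j) ⟨
    (suc k * suc j) * k ^ j    ≤⟨ *-monoˡ-≤ (k ^ j) (*-shuffle-≤ j<k) ⟩
    (suc (suc j) * k) * k ^ j  ≡⟨ *-assoc (suc (suc j)) k (k ^ j) ⟩
    suc (suc j) * (k * k ^ j)  ∎
    where
    open ≤-Reasoning
    *-shuffle-≤ : suc j ≤ k → suc k * suc j ≤ suc (suc j) * k
    *-shuffle-≤ j<k = begin
      suc k * suc j        ≡⟨ expand k j ⟩
      suc j + k * suc j    ≤⟨ +-monoˡ-≤ (k * suc j) j<k ⟩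
      k + k * suc j        ≡⟨ collect k j ⟩
      suc (suc j) * k      ∎
      where
      expand : ∀ k j → suc k * suc j ≡ suc j + k * suc j
      expand = solve-∀
      collect : ∀ k j → k + k * suc j ≡ suc (suc j) * k
      collect = solve-∀

  [1+s+i]^s≤[1+s]^[s+i] : ∀ s i → (suc s + i) ^ s ≤ suc s ^ (s + i)
  [1+s+i]^s≤[1+s]^[s+i] s zero    rewrite +-identityʳ s = ≤-refl
  [1+s+i]^s≤[1+s]^[s+i] s (suc i) = begin
    (suc s + suc i) ^ s        ≡⟨ cong (_^ s) (+-suc (suc s) i) ⟩
    suc (suc s + i) ^ s        ≤⟨ [1+k]^j≤[1+j]*k^j (suc s + i) s (≤-trans (n≤1+n s) (m≤m+n (suc s) i)) ⟩
    suc s * (suc s + i) ^ s    ≤⟨ *-monoʳ-≤ (suc s) ([1+s+i]^s≤[1+s]^[s+i] s i) ⟩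
    suc s * suc s ^ (s + i)    ≡⟨ cong (suc s ^_) (+-suc s i) ⟨
    suc s ^ (s + suc i)        ∎
    where open ≤-Reasoning

  [1+k]^[k∸j]≤[1+k∸j]^k : ∀ k j → j ≤ k → suc k ^ (k ∸ j) ≤ (suc k ∸ j) ^ k
  [1+k]^[k∸j]≤[1+k∸j]^k k j j≤k = begin
    suc k ^ (k ∸ j)                    ≡⟨ cong (λ m → suc m ^ (k ∸ j)) (m∸n+n≡m j≤k) ⟨
    suc (k ∸ j + j) ^ (k ∸ j)          ≤⟨ [1+s+i]^s≤[1+s]^[s+i] (k ∸ j) j ⟩
    suc (k ∸ j) ^ (k ∸ j + j)          ≡⟨ cong₂ _^_ (+-∸-assoc 1 j≤k) (sym (m∸n+n≡m j≤k)) ⟨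
    (suc k ∸ j) ^ k                    ∎
    where open ≤-Reasoning

  m+n∸o≤m+[n∸o] : ∀ m n o → m + n ∸ o ≤ m + (n ∸ o)
  m+n∸o≤m+[n∸o] m n       zero    = ≤-refl
  m+n∸o≤m+[n∸o] m zero    (suc o) = m∸n≤m (m + 0) (suc o)
  m+n∸o≤m+[n∸o] m (suc n) (suc o) rewrite +-suc m n = m+n∸o≤m+[n∸o] m n o

  m+n∸o≤[m∸j]+[n∸[o∸j]] : ∀ m n o j → j ≤ m → j ≤ o → m + n ∸ o ≤ (m ∸ j) + (n ∸ (o ∸ j))
  m+n∸o≤[m∸j]+[n∸[o∸j]] m       n o       zero    _         _         = m+n∸o≤m+[n∸o] m n o
  m+n∸o≤[m∸j]+[n∸[o∸j]] (suc m) n (suc o) (suc j) (s≤s j≤m) (s≤s j≤o) = m+n∸o≤[m∸j]+[n∸[o∸j]] m n o j j≤m j≤o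

  -- One step of the induction on the number of variables: with k = 1 + K colours the exponent K n ∸ d
  -- grows by K ∸ j, which the factor k ∸ j pays for since k ^ (K ∸ j) ≤ (k ∸ j) ^ K.
  exponent-step : ∀ K n d j H C → j ≤ d → j ≤ K →
    suc K ^ (K * n ∸ (d ∸ j)) ≤ H ^ K → (suc K ∸ j) * H ≤ C → suc K ^ (K * suc n ∸ d) ≤ C ^ K
  exponent-step K n d j H C j≤d j≤K ih kH≤C = begin
    suc K ^ (K * suc n ∸ d)                       ≤⟨ ^-monoʳ-≤ (suc K) exponent≤ ⟩
    suc K ^ ((K ∸ j) + (K * n ∸ (d ∸ j)))         ≡⟨ ^-distribˡ-+-* (suc K) (K ∸ j) _ ⟩
    suc K ^ (K ∸ j) * suc K ^ (K * n ∸ (d ∸ j))   ≤⟨ *-mono-≤ ([1+k]^[k∸j]≤[1+k∸j]^k K j j≤K) ih ⟩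
    (suc K ∸ j) ^ K * H ^ K                       ≡⟨ ^-distribʳ-* (suc K ∸ j) H K ⟨
    ((suc K ∸ j) * H) ^ K                         ≤⟨ ^-monoˡ-≤ K kH≤C ⟩
    C ^ K                                         ∎
    where
    open ≤-Reasoning
    exponent≤ : K * suc n ∸ d ≤ (K ∸ j) + (K * n ∸ (d ∸ j))
    exponent≤ rewrite *-suc K n = m+n∸o≤[m∸j]+[n∸[o∸j]] K (K * n) d j j≤K j≤d

module AlonFüredi where

  open import Data.Nat
  open import Data.Nat.Properties
  open import Data.Integer as ℤ using (ℤ; 0ℤ)
  import Data.Integer.Properties as ℤ
  open import Data.List using (List; []; _∷_; length; map)
  open import Data.List.Membership.Propositional using (_∈_)
  open import Data.List.Relation.Unary.All as All using (All)
  import Data.List.Relation.Unary.All.Properties as All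
  open import Data.List.Relation.Unary.AllPairs using (AllPairs)
  open import Data.Vec using (Vec; []; _∷_)
  open import Data.Product using (Σ; _×_; _,_)
  open import Data.Sum using (_⊎_; inj₁; inj₂; [_,_]′)
  open import Data.Empty using (⊥-elim)
  open import Relation.Nullary using (¬_; yes; no)
  open import Function using (_∘_)
  open import Relation.Binary.PropositionalEquality
  open Sums
  open Univariate using (⟦_⟧; ⟦[c]⟧≡c; LeadingNonZero)
  open NonZeroCount
  open Polynomial
  open Reduction using (reduceᶠ; ⟦⟧-reduceᶠ; length-reduceᶠ; IsCoefficientList-reduceᶠ)
  open PowerInequalities using (exponent-step)

  module _ (A : List ℤ) where

    VanishesOnGrid : ∀ {n} → Fun n → Set
    VanishesOnGrid {n} f = All (λ x → f x ≡ 0ℤ) (assignments A n)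

    All-assignments-suc : ∀ {n} {P : Vec ℤ (suc n) → Set} →
      (∀ {t x} → t ∈ A → x ∈ assignments A n → P (t ∷ x)) → All P (assignments A (suc n))
    All-assignments-suc P[t∷x] = All.concat⁺ (All.map⁺ (All.tabulate λ t∈A → All.map⁺ (All.tabulate (P[t∷x] t∈A))))

    countNonZero-assignments-suc : ∀ {n} (f : Fun (suc n)) →
      countNonZero (assignments A (suc n)) f ≡ ∑[ x ∈ assignments A n ] countNonZero A (λ t → f (t ∷ x))
    countNonZero-assignments-suc {n} f = begin
      countNonZero (assignments A (suc n)) f
        ≡⟨ ∑-concatMap (λ t → map (t ∷_) (assignments A n)) A (λ w → indicator≢0 (f w)) ⟩
      ∑[ t ∈ A ] ∑ (map (t ∷_) (assignments A n)) (λ w → indicator≢0 (f w))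
        ≡⟨ ∑-cong A (λ {t} _ → ∑-map (t ∷_) (assignments A n) (λ w → indicator≢0 (f w))) ⟩
      ∑[ t ∈ A ] ∑[ x ∈ assignments A n ] indicator≢0 (f (t ∷ x))
        ≡⟨ ∑-comm A (assignments A n) (λ t x → indicator≢0 (f (t ∷ x))) ⟩
      ∑[ x ∈ assignments A n ] countNonZero A (λ t → f (t ∷ x)) ∎
      where open ≡-Reasoning

    FibreOfDegree : ∀ {n} → List (Fun n) → Vec ℤ n → ℕ → Set
    FibreOfDegree gs x j = Σ (List ℤ) λ ws → length ws ≡ suc j × LeadingNonZero ws × (∀ t → ⟦ gs at x ⟧ t ≡ ⟦ ws ⟧ t)

    record TopCoefficient (n d : ℕ) (gs : List (Fun n)) : Set where
      field
        index          : ℕ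
        coefficient    : Fun n
        index≤d        : index ≤ d
        index<length   : index < length gs
        isPolynomial   : IsPolynomial n (d ∸ index) coefficient
        nonVanishing   : ¬ VanishesOnGrid coefficient
        truncation     : ∀ {x} → x ∈ assignments A n → ¬ coefficient x ≡ 0ℤ → FibreOfDegree gs x index

    VanishesOnFibres : ∀ n → List (Fun n) → Set
    VanishesOnFibres n gs = ∀ {x} → x ∈ assignments A n → ∀ t → ⟦ gs at x ⟧ t ≡ 0ℤ

    topCoefficient-∷-vanishing : ∀ {n d} g (gs : List (Fun n)) → IsPolynomial n d g → VanishesOnFibres n gs →
      VanishesOnFibres n (g ∷ gs) ⊎ TopCoefficient n d (g ∷ gs)
    topCoefficient-∷-vanishing {n} {d} g gs p gs≈0 with All.all? (λ x → g x ℤ.≟ 0ℤ) (assignments A n)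
    ... | yes g≈0 = inj₁ λ {x} x∈ t →
      trans (cong₂ (λ u v → u ℤ.+ t ℤ.* v) (All.lookup g≈0 x∈) (gs≈0 x∈ t)) (⟦[c]⟧≡c 0ℤ t)
    ... | no  g≉0 = inj₂ record
      { index = 0 ; coefficient = g ; index≤d = z≤n ; index<length = s≤s z≤n ; isPolynomial = p ; nonVanishing = g≉0
      ; truncation = λ {x} x∈ gx≢0 → g x ∷ [] , refl , gx≢0 ,
                     λ t → cong (λ v → g x ℤ.+ t ℤ.* v) (gs≈0 x∈ t)
      }

    topCoefficient-∷ : ∀ {n d} g (gs : List (Fun n)) → TopCoefficient n d gs → TopCoefficient n (suc d) (g ∷ gs)
    topCoefficient-∷ g gs top = record
      { index = suc index ; coefficient = coefficient ; index≤d = s≤s index≤d ; index<length = s≤s index<length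
      ; isPolynomial = isPolynomial ; nonVanishing = nonVanishing
      ; truncation = λ {x} x∈ hx≢0 → extend x (truncation x∈ hx≢0)
      }
      where
      open TopCoefficient top
      extend : ∀ x → FibreOfDegree gs x index → FibreOfDegree (g ∷ gs) x (suc index)
      extend x (w ∷ ws , len , lead , eq) = g x ∷ w ∷ ws , cong suc len , lead , λ t → cong (λ u → g x ℤ.+ t ℤ.* u) (eq t)

    topCoefficient : ∀ n d (gs : List (Fun n)) → IsCoefficientList n d gs → VanishesOnFibres n gs ⊎ TopCoefficient n d gs
    topCoefficient n d       []        _          = inj₁ λ _ _ → refl
    topCoefficient n zero    (g ∷ .[]) (p , refl) = topCoefficient-∷-vanishing g [] p (λ _ _ → refl)
    topCoefficient n (suc d) (g ∷ gs)  (p , cl)   =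
      [ topCoefficient-∷-vanishing g gs p , inj₂ ∘ topCoefficient-∷ g gs ]′ (topCoefficient n d gs cl)

  module _ (A : List ℤ) (K : ℕ) (|A|≡1+K : length A ≡ suc K) (distinct : AllPairs (λ a b → ¬ a ≡ b) A) where

    module _ {n d} (f : Fun (suc n)) (gs : List (Fun n)) (f≡gs : ∀ {t x} → t ∈ A → f (t ∷ x) ≡ ⟦ gs at x ⟧ t)
             (top : TopCoefficient A n d gs) where

      open TopCoefficient top

      -- Along such a fibre f is a polynomial in t of degree index, so it has at most index roots in A.
      countNonZero-fibre : ∀ {x} → x ∈ assignments A n → ¬ coefficient x ≡ 0ℤ → suc K ∸ index ≤ countNonZero A (λ t → f (t ∷ x))
      countNonZero-fibre {x} x∈ hx≢0 with truncation x∈ hx≢0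
      ... | c ∷ cs , len , lead , gs≡ws = begin
        suc K ∸ index                       ≤⟨ m≤n+o⇒m∸n≤o (suc K) index k≤index+count ⟩
        countNonZero A ⟦ c ∷ cs ⟧           ≡⟨ ∑-cong A (λ t∈A → cong indicator≢0 (trans (f≡gs t∈A) (gs≡ws _))) ⟨
        countNonZero A (λ t → f (t ∷ x))    ∎
        where
        open ≤-Reasoning
        k≤index+count : suc K ≤ index + countNonZero A ⟦ c ∷ cs ⟧
        k≤index+count = begin
          suc K                                ≡⟨ |A|≡1+K ⟨
          length A                             ≤⟨ length≤countNonZero+degree A distinct index c cs len lead ⟩
          countNonZero A ⟦ c ∷ cs ⟧ + index    ≡⟨ +-comm _ index ⟩
          index + countNonZero A ⟦ c ∷ cs ⟧    ∎

      countNonZero-fibres : (suc K ∸ index) * countNonZero (assignments A n) coefficient ≤ countNonZero (assignments A (suc n)) f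
      countNonZero-fibres = begin
        (suc K ∸ index) * countNonZero (assignments A n) coefficient
          ≡⟨ *-distribˡ-∑ (suc K ∸ index) (assignments A n) _ ⟩
        ∑[ x ∈ assignments A n ] ((suc K ∸ index) * indicator≢0 (coefficient x))
          ≤⟨ ∑-mono-≤ (assignments A n) (λ {x} x∈ → *-indicator≢0-≤ (suc K ∸ index) (coefficient x) (countNonZero-fibre x∈)) ⟩
        ∑[ x ∈ assignments A n ] countNonZero A (λ t → f (t ∷ x))
          ≡⟨ countNonZero-assignments-suc A f ⟨
        countNonZero (assignments A (suc n)) f ∎
        where open ≤-Reasoning

    countNonZero-assignments-zero : (f : Fun 0) → ¬ VanishesOnGrid A f → countNonZero (assignments A 0) f ≡ 1
    countNonZero-assignments-zero f f≉0 = cong (_+ 0) (indicator≢0-≢0 λ f[]≡0 → f≉0 (f[]≡0 All.∷ All.[]))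

    -- k ^ (n − d / (k − 1)) ≤ (number of grid points where f ≠ 0), with both sides raised to the power k − 1 = K.
    alonFüredi : ∀ n d f → IsPolynomial n d f → ¬ VanishesOnGrid A f → suc K ^ (K * n ∸ d) ≤ countNonZero (assignments A n) f ^ K
    alonFüredi zero d f _ f≉0 = begin
      suc K ^ (K * 0 ∸ d)                        ≡⟨ cong (λ e → suc K ^ (e ∸ d)) (*-zeroʳ K) ⟩
      suc K ^ (0 ∸ d)                            ≡⟨ cong (suc K ^_) (0∸n≡0 d) ⟩
      1                                          ≡⟨ ^-zeroˡ K ⟨
      1 ^ K                                      ≡⟨ cong (_^ K) (countNonZero-assignments-zero f f≉0) ⟨
      countNonZero (assignments A 0) f ^ K       ∎
      where open ≤-Reasoning
    alonFüredi (suc n) d f (gs , cl , f≡) f≉0 =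
      [ (λ gs′≈0 → ⊥-elim (f≉0 (All-assignments-suc A λ t∈A x∈ → trans (f≡gs′ t∈A) (gs′≈0 x∈ _))))
      , (λ top → let open TopCoefficient top in
           exponent-step K n d index _ _ index≤d (index≤K top)
             (alonFüredi n (d ∸ index) coefficient isPolynomial nonVanishing) (countNonZero-fibres f gs′ f≡gs′ top))
      ]′ (topCoefficient A n d gs′ (IsCoefficientList-reduceᶠ A n 0 d gs cl))
      where
      gs′ = reduceᶠ A 0 gs

      f≡gs′ : ∀ {t x} → t ∈ A → f (t ∷ x) ≡ ⟦ gs′ at x ⟧ t
      f≡gs′ {t} {x} t∈A = trans (f≡ t x) (sym (trans (⟦⟧-reduceᶠ A 0 gs x t∈A) (ℤ.*-identityˡ _)))

      index≤K : (top : TopCoefficient A n d gs′) → TopCoefficient.index top ≤ K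
      index≤K top = ≤-pred (≤-trans (TopCoefficient.index<length top) (≤-trans (length-reduceᶠ A 0 gs) (≤-reflexive |A|≡1+K)))

module ColourSets where

  open import Data.Nat
  open import Data.Nat.Properties
  open import Data.Nat.DivMod using (m/n≡1+[m∸n]/n)
  open import Data.Integer as ℤ using (ℤ; 0ℤ; +_; ∣_∣)
  import Data.Integer.Properties as ℤ
  open import Data.List using (List; []; _∷_; _++_; length)
  open import Data.List.Membership.Propositional using (_∈_)
  open import Data.List.Membership.Propositional.Properties using (∈-++⁺ˡ; ∈-++⁻)
  open import Data.List.Relation.Unary.Any using (here; there)
  open import Data.List.Relation.Unary.All as All using (All; []; _∷_)
  open import Data.List.Relation.Unary.AllPairs using (AllPairs; []; _∷_)
  import Data.List.Relation.Unary.AllPairs.Properties as AllPairs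
  open import Data.Product using (∃; _,_; proj₂)
  open import Data.Fin using (Fin)
  open import Data.Bool using (if_then_else_)
  open import Data.Sum using (_⊎_; inj₁; inj₂)
  open import Data.Empty using (⊥-elim)
  open import Relation.Nullary using (¬_; yes; no; does)
  open import Function using (_∘_)
  open import Relation.Binary.PropositionalEquality

  length-M : ∀ k → length (M k) ≡ k
  length-M zero          = refl
  length-M (suc zero)    = refl
  length-M (suc (suc k)) = cong (suc ∘ suc) (length-M k)

  ±[1‥_] : ℕ → List ℤ
  ±[1‥ zero  ] = []
  ±[1‥ suc t ] = + suc t ∷ ℤ.- + suc t ∷ ±[1‥ t ]

  [2+m]/2≡1+m/2 : ∀ m → suc (suc m) / 2 ≡ suc (m / 2)
  [2+m]/2≡1+m/2 m = m/n≡1+[m∸n]/n {suc (suc m)} {2} (s≤s (s≤s z≤n))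

  [t+t]/2≡t : ∀ t → (t + t) / 2 ≡ t
  [t+t]/2≡t zero    = refl
  [t+t]/2≡t (suc t) =
    trans (cong (λ m → suc m / 2) (+-suc t t)) (trans ([2+m]/2≡1+m/2 (t + t)) (cong suc ([t+t]/2≡t t)))

  [1+t+t]/2≡t : ∀ t → suc (t + t) / 2 ≡ t
  [1+t+t]/2≡t zero    = refl
  [1+t+t]/2≡t (suc t) =
    trans (cong (λ m → suc (suc m) / 2) (+-suc t t)) (trans ([2+m]/2≡1+m/2 (suc (t + t))) (cong suc ([1+t+t]/2≡t t)))

  M-even : ∀ t → M (t + t) ≡ ±[1‥ t ]
  M-[2+t+t] : ∀ t → M (suc (suc (t + t))) ≡ ±[1‥ suc t ]

  M-even zero    = refl
  M-even (suc t) rewrite +-suc t t = M-[2+t+t] t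

  M-[2+t+t] t rewrite [t+t]/2≡t t | M-even t = refl

  M-odd : ∀ t → M (suc (t + t)) ≡ ±[1‥ t ] ++ 0ℤ ∷ []
  M-odd zero    = refl
  M-odd (suc t) rewrite +-suc t t | [1+t+t]/2≡t t | M-odd t = refl

  ∣∣≤-±[1‥] : ∀ t {x} → x ∈ ±[1‥ t ] → ∣ x ∣ ≤ t
  ∣∣≤-±[1‥] (suc t) (here refl)         = ≤-refl
  ∣∣≤-±[1‥] (suc t) (there (here refl)) = ≤-refl
  ∣∣≤-±[1‥] (suc t) (there (there x∈))  = m≤n⇒m≤1+n (∣∣≤-±[1‥] t x∈)

  ±[1‥]-nonZero : ∀ t {x} → x ∈ ±[1‥ t ] → ¬ x ≡ 0ℤ
  ±[1‥]-nonZero (suc t) (here refl)         ()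
  ±[1‥]-nonZero (suc t) (there (here refl)) ()
  ±[1‥]-nonZero (suc t) (there (there x∈))  = ±[1‥]-nonZero t x∈

  ∉-±[1‥] : ∀ t {y} → t < ∣ y ∣ → All (λ x → ¬ y ≡ x) ±[1‥ t ]
  ∉-±[1‥] t t<∣y∣ = All.tabulate λ x∈ y≡x → <⇒≱ t<∣y∣ (subst (λ z → ∣ z ∣ ≤ t) (sym y≡x) (∣∣≤-±[1‥] t x∈))

  distinct-±[1‥] : ∀ t → AllPairs (λ x y → ¬ x ≡ y) ±[1‥ t ]
  distinct-±[1‥] zero    = []
  distinct-±[1‥] (suc t) = ((λ ()) ∷ ∉-±[1‥] t ≤-refl) ∷ ∉-±[1‥] t ≤-refl ∷ distinct-±[1‥] t

  even-or-odd : ∀ k → (∃ λ t → k ≡ t + t) ⊎ (∃ λ t → k ≡ suc (t + t))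
  even-or-odd zero = inj₁ (0 , refl)
  even-or-odd (suc k) with even-or-odd k
  ... | inj₁ (t , refl) = inj₂ (t , refl)
  ... | inj₂ (t , refl) = inj₁ (suc t , cong suc (sym (+-suc t t)))

  distinct-M : ∀ k → AllPairs (λ x y → ¬ x ≡ y) (M k)
  distinct-M k with even-or-odd k
  ... | inj₁ (t , refl) = subst (AllPairs _) (sym (M-even t)) (distinct-±[1‥] t)
  ... | inj₂ (t , refl) = subst (AllPairs _) (sym (M-odd t))
          (AllPairs.++⁺ (distinct-±[1‥] t) ([] ∷ []) (All.tabulate λ x∈ → ±[1‥]-nonZero t x∈ ∷ []))

  ∣sign*∣ : ∀ s y → ∣ signVal s ℤ.* y ∣ ≡ ∣ y ∣
  ∣sign*∣ pos y = cong ∣_∣ (ℤ.*-identityˡ y)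
  ∣sign*∣ neg y = trans (cong ∣_∣ (ℤ.-1*i≡-i y)) (ℤ.∣-i∣≡∣i∣ y)

  recolour : ∀ {n} (G : SignedGraph n) {j j′} {κ : Fin n → ℤ} (ρ : ℤ → ℤ) →
    (∀ {a} → a ∈ M j → ρ a ∈ M j′) →
    (∀ {a b} s → a ∈ M j → b ∈ M j → ρ a ≡ signVal s ℤ.* ρ b → a ≡ signVal s ℤ.* b) →
    IsColoring G j κ → IsColoring G j′ (λ x → ρ (κ x))
  recolour G {κ = κ} ρ into reflect (κ∈M , proper) = (λ x → into (κ∈M x)) , All.map (λ {e} → edgeOK e) proper
    where
    edgeOK : ∀ e → EdgeOK κ e → EdgeOK (λ x → ρ (κ x)) e
    edgeOK (u , v , s) κv≢sκu ρκv≡sρκu = κv≢sκu (reflect s (κ∈M v) (κ∈M u) ρκv≡sρκu)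

  raiseZero : ℕ → ℤ → ℤ
  raiseZero t a = if does (a ℤ.≟ 0ℤ) then + suc t else a

  ∣∣≤-M-odd : ∀ t {a} → a ∈ M (suc (t + t)) → ∣ a ∣ ≤ t
  ∣∣≤-M-odd t a∈ with ∈-++⁻ ±[1‥ t ] (subst (_ ∈_) (M-odd t) a∈)
  ... | inj₁ a∈±    = ∣∣≤-±[1‥] t a∈±
  ... | inj₂ (here refl) = z≤n

  -- From 2t + 1 to 2t + 2 colours: the colour 0 is replaced by the new colour t + 1.
  raiseZero-into : ∀ t {a} → a ∈ M (suc (t + t)) → raiseZero t a ∈ M (suc (suc (t + t)))
  raiseZero-into t {a} a∈ rewrite M-[2+t+t] t with ∈-++⁻ ±[1‥ t ] (subst (_ ∈_) (M-odd t) a∈)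
  ... | inj₂ (here refl) = here refl
  ... | inj₁ a∈± with a ℤ.≟ 0ℤ
  ...   | yes a≡0 = ⊥-elim (±[1‥]-nonZero t a∈± a≡0)
  ...   | no  _   = there (there a∈±)

  raiseZero-reflects : ∀ t {a b} s → a ∈ M (suc (t + t)) → b ∈ M (suc (t + t)) →
    raiseZero t a ≡ signVal s ℤ.* raiseZero t b → a ≡ signVal s ℤ.* b
  raiseZero-reflects t {a} {b} s a∈ b∈ eq with a ℤ.≟ 0ℤ | b ℤ.≟ 0ℤ
  ... | yes refl | yes refl = sym (ℤ.*-zeroʳ (signVal s))
  ... | yes refl | no  _    = ⊥-elim (1+n≰n (subst (_≤ t) (trans (sym (∣sign*∣ s b)) (cong ∣_∣ (sym eq))) (∣∣≤-M-odd t b∈)))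
  ... | no  _    | yes refl = ⊥-elim (1+n≰n (subst (_≤ t) (trans (cong ∣_∣ eq) (∣sign*∣ s (+ suc t))) (∣∣≤-M-odd t a∈)))
  ... | no  _    | no  _    = eq

  colouring-suc : ∀ {n} (G : SignedGraph n) k {κ} → IsColoring G k κ → ∃ λ κ′ → IsColoring G (suc k) κ′
  colouring-suc G k col with even-or-odd k
  ... | inj₁ (t , refl) = _ , recolour G (λ a → a)
          (λ a∈ → subst (_ ∈_) (sym (M-odd t)) (∈-++⁺ˡ (subst (_ ∈_) (M-even t) a∈))) (λ _ _ _ eq → eq) col
  ... | inj₂ (t , refl) = _ , recolour G {j′ = suc (suc (t + t))} (raiseZero t) (raiseZero-into t) (raiseZero-reflects t) col

  colouring-+ : ∀ {n} (G : SignedGraph n) i j {κ} → IsColoring G j κ → ∃ λ κ′ → IsColoring G (i + j) κ′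
  colouring-+ G zero    j col = _ , col
  colouring-+ G (suc i) j col = colouring-suc G (i + j) (proj₂ (colouring-+ G i j col))

  chiAtMost⇒colouring : ∀ {n} (G : SignedGraph n) k → ChiAtMost G k → ∃ λ κ → IsColoring G k κ
  chiAtMost⇒colouring G k (j , j≤k , κ , col) = subst (λ m → ∃ (IsColoring G m)) (m∸n+n≡m j≤k) (colouring-+ G (k ∸ j) j col)

module CountingColourings where

  open import Data.Nat using (ℕ; zero; suc; _≤_; _*_; _∸_; _^_)
  open import Data.Integer as ℤ using (ℤ; 0ℤ; 1ℤ)
  import Data.Integer.Properties as ℤ
  open import Data.List using (List; []; _∷_; length; filter; map)
  open import Data.List.Membership.Propositional using (_∈_)
  open import Data.List.Membership.Propositional.Properties using (∈-map⁺; ∈-concatMap⁺)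
  open import Data.List.Relation.Unary.Any as Any using ()
  open import Data.List.Relation.Unary.All as All using (All; []; _∷_)
  open import Data.Vec as Vec using (Vec; lookup; tabulate)
  open import Data.Vec.Properties using (lookup∘tabulate)
  open import Data.Fin using (Fin; zero; suc)
  open import Data.Product using (_,_)
  open import Data.Sum using ([_,_]′)
  open import Data.Empty using (⊥-elim)
  open import Relation.Nullary using (¬_; yes; no)
  open import Function using (_∘_)
  open import Relation.Binary.PropositionalEquality
  open Polynomial
  open NonZeroCount
  open AlonFüredi using (VanishesOnGrid; alonFüredi)
  open ColourSets using (length-M; distinct-M; chiAtMost⇒colouring)

  edgeForm : ∀ {n} → Edge n → Fun n
  edgeForm (u , v , s) x = lookup x v ℤ.- signVal s ℤ.* lookup x u

  -- ∏_{uv ∈ E} (x_v − ε(uv) x_u): its nonzeros on M_k ^ n are exactly the k-colourings.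
  edgeProduct : ∀ {n} → List (Edge n) → Fun n
  edgeProduct []       x = 1ℤ
  edgeProduct (e ∷ es) x = edgeForm e x ℤ.* edgeProduct es x

  IsPolynomial-edgeProduct : ∀ {n} (es : List (Edge n)) → IsPolynomial n (length es) (edgeProduct es)
  IsPolynomial-edgeProduct {n} []                = IsPolynomial-const n 0 1ℤ
  IsPolynomial-edgeProduct {n} ((u , v , s) ∷ es) =
    IsPolynomial-*-affine n (length es) (IsPolynomial-edgeProduct es) (IsAffine-sub n (signVal s) (IsAffine-lookup n v) (IsAffine-lookup n u))

  proper⇒edgeProduct≢0 : ∀ {n} (es : List (Edge n)) x → All (EdgeOK (lookup x)) es → ¬ edgeProduct es x ≡ 0ℤ
  proper⇒edgeProduct≢0 []                x []                ()
  proper⇒edgeProduct≢0 ((u , v , s) ∷ es) x (xv≢sxu ∷ proper) ≡0 =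
    [ (λ form≡0 → xv≢sxu (ℤ.i-j≡0⇒i≡j _ _ form≡0)) , proper⇒edgeProduct≢0 es x proper ]′ (ℤ.i*j≡0⇒i≡0∨j≡0 _ ≡0)

  edgeProduct≢0⇒proper : ∀ {n} (es : List (Edge n)) x → ¬ edgeProduct es x ≡ 0ℤ → All (EdgeOK (lookup x)) es
  edgeProduct≢0⇒proper []                x _  = []
  edgeProduct≢0⇒proper ((u , v , s) ∷ es) x ≢0 =
    (λ xv≡sxu → ≢0 (trans (cong (ℤ._* edgeProduct es x) (ℤ.i≡j⇒i-j≡0 xv≡sxu)) (ℤ.*-zeroˡ (edgeProduct es x)))) ∷
    edgeProduct≢0⇒proper es x (λ ≡0 → ≢0 (trans (cong (edgeForm (u , v , s) x ℤ.*_) ≡0) (ℤ.*-zeroʳ (edgeForm (u , v , s) x))))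

  length-filter-proper : ∀ {n} (es : List (Edge n)) ws →
    length (filter (λ w → All.all? (edgeOK? (lookup w)) es) ws) ≡ countNonZero ws (edgeProduct es)
  length-filter-proper es []       = refl
  length-filter-proper es (w ∷ ws) with All.all? (edgeOK? (lookup w)) es | edgeProduct es w ℤ.≟ 0ℤ
  ... | yes proper | yes ≡0 = ⊥-elim (proper⇒edgeProduct≢0 es w proper ≡0)
  ... | yes _      | no  _  = cong suc (length-filter-proper es ws)
  ... | no  _      | yes _  = length-filter-proper es ws
  ... | no  ¬proper | no ≢0 = ⊥-elim (¬proper (edgeProduct≢0⇒proper es w ≢0))

  P≡countNonZero : ∀ {n} (G : SignedGraph n) k → P G k ≡ countNonZero (assignments (M k) n) (edgeProduct (edges G))
  P≡countNonZero {n} G k = length-filter-proper (edges G) (assignments (M k) n)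

  tabulate∈assignments : ∀ (A : List ℤ) n (κ : Fin n → ℤ) → (∀ i → κ i ∈ A) → tabulate κ ∈ assignments A n
  tabulate∈assignments A zero    κ κ∈A = Any.here refl
  tabulate∈assignments A (suc n) κ κ∈A = ∈-concatMap⁺ (λ c → map (c Vec.∷_) (assignments A n))
    (Any.map (λ { refl → ∈-map⁺ (κ zero Vec.∷_) (tabulate∈assignments A n (κ ∘ suc) (κ∈A ∘ suc)) }) (κ∈A zero))

  colouring⇒edgeProduct≉0 : ∀ {n} (G : SignedGraph n) k {κ} → IsColoring G k κ → ¬ VanishesOnGrid (M k) (edgeProduct (edges G))
  colouring⇒edgeProduct≉0 {n} G k {κ} (κ∈M , proper) ≈0 =
    proper⇒edgeProduct≢0 (edges G) (tabulate κ) (All.map (λ {e} → tabulate-edgeOK e) proper)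
      (All.lookup ≈0 (tabulate∈assignments (M k) n κ κ∈M))
    where
    tabulate-edgeOK : ∀ e → EdgeOK κ e → EdgeOK (lookup (tabulate κ)) e
    tabulate-edgeOK (u , v , s) κv≢sκu eq =
      κv≢sκu (trans (sym (lookup∘tabulate κ v)) (trans eq (cong (signVal s ℤ.*_) (lookup∘tabulate κ u))))

  chromaticCount-bound : ∀ n (G : SignedGraph n) K → ChiAtMost G (suc K) → suc K ^ (K * n ∸ numEdges G) ≤ P G (suc K) ^ K
  chromaticCount-bound n G K χ≤k with chiAtMost⇒colouring G (suc K) χ≤k
  ... | κ , colouring = subst (λ c → suc K ^ (K * n ∸ numEdges G) ≤ c ^ K) (sym (P≡countNonZero G (suc K)))
    (alonFüredi (M (suc K)) K (length-M (suc K)) (distinct-M (suc K)) n (numEdges G) (edgeProduct (edges G))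
       (IsPolynomial-edgeProduct (edges G)) (colouring⇒edgeProduct≉0 G (suc K) colouring))

open import Data.Nat using (ℕ; suc; _≤_; _*_; _∸_; _^_)
open import Data.Nat.Properties using (m^n>0)
open import Data.Nat.Primality using (Prime; prime⇒nonZero)
open CountingColourings using (chromaticCount-bound)

-- The bound holds for every k ≥ 1: primality only ensures p ^ r ≠ 0, and when m > (k − 1) n the
-- truncated exponent is 0.
theorem4p6 : (n : ℕ) (G : SignedGraph n) (p r : ℕ) → Prime p → 1 ≤ r →
    ChiAtMost G (p ^ r) → numEdges G ≤ (p ^ r ∸ 1) * n →
    (p ^ r) ^ ((p ^ r ∸ 1) * n ∸ numEdges G) ≤ P G (p ^ r) ^ (p ^ r ∸ 1)
theorem4p6 n G p r p-prime _ χ≤k _ with p ^ r | m^n>0 p {{prime⇒nonZero p-prime}} r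
... | suc K | _ = chromaticCount-bound n G K χ≤k
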